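{- Let $\mathsf{Comp}$ be the nonsymmetric sub-operad of $\mathsf{T}\mathbb{N}_2$ generated by the words $00$ and $01$. Then the elements of $\mathsf{Comp}$ are exactly the nonempty words over the alphabet $\{0,1\}$ that begin with $0$. Moreover, for every $n\ge1$, the elements of $\mathsf{Comp}$ of arity $n$ are in bijection with the compositions of the integer $n$. Finally, $\mathsf{Comp}$ is isomorphic to the nonsymmetric operad generated by two generators $a$ and $b$ of arity two subject to the four relations $a\circ_1 a = a\circ_2 a$, $b\circ_1 a = a\circ_2 b$, $b\circ_1 b = b\circ_2 a$, $a\circ_1 b = b\circ_2 b$.
   Context: $\mathbb{N}_2 = \{0,1\}$ denotes the additive monoid of integers modulo $2$. $\mathsf{T}\mathbb{N}_2 := \biguplus_{n\ge1}\mathbb{N}_2^n$ is the set of nonempty words over $\mathbb{N}_2$, a word of length $n$ having arity $n$, with partial compositions $x\circ_i y := (x_1,\dots,x_{i-1}, x_i+y_1,\dots,x_i+y_m, x_{i+1},\dots,x_n)$ (sums modulo $2$) for $x$ of length $n$, $y$ of length $m$, $1\le i\le n$; its unit is the word $0$ of length $1$. The nonsymmetric sub-operad generated by a set $G$ of words is the smallest subset containing $G$ and the unit and closed under all partial compositions $\circ_i$. A composition of $n$ is a finite sequence of positive integers summing to $n$. The nonsymmetric operad generated by generators subject to relations is the quotient of the free nonsymmetric set-operad on these generators by the smallest operad congruence containing the relations. -}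

module Defs where

open import Data.Bool using (Bool; true; false; _xor_)
open import Data.Nat using (ℕ; zero; suc; _+_; _<_)
open import Data.List using (List; []; _∷_; length; map; _++_)
open import Data.Nat.ListAction using (sum)
open import Data.List.Relation.Unary.All using (All)
open import Data.Fin using (Fin; zero; suc; splitAt; cast)
open import Data.Sum using (_⊎_; inj₁; inj₂)
open import Data.Product using (Σ; _×_; _,_; proj₁; ∃-syntax)
open import Relation.Binary.PropositionalEquality using (_≡_)
open import Relation.Binary.Bundles using (Setoid)
open import Relation.Binary.Construct.On as On using ()
import Relation.Binary.PropositionalEquality as P

-- The monoid ℕ₂ = {0,1} under addition mod 2: 0 ↦ false, 1 ↦ true,
-- addition mod 2 is _xor_.

ℕ₂ : Set
ℕ₂ = Bool

-- The operad Tℕ₂.  Its elements are the nonempty words over ℕ₂; a word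
-- is represented as a list, its arity is its length.

Word : Set
Word = List ℕ₂

-- x ∘[ i ] y  =  (x₁,…,x_{i-1}, x_i+y₁,…,x_i+y_m, x_{i+1},…,x_n)
-- (position i is 0-based here: Fin (length x)).
_∘[_]_ : (x : Word) → Fin (length x) → Word → Word
(a ∷ x) ∘[ zero ]  y = map (a xor_) y ++ x
(a ∷ x) ∘[ suc i ] y = a ∷ (x ∘[ i ] y)

𝟙 : Word
𝟙 = false ∷ []

data Generated (G : Word → Set) : Word → Set where
  gen  : ∀ {w} → G w → Generated G w
  unit : Generated G 𝟙
  comp : ∀ {x y} → Generated G x → Generated G y → (i : Fin (length x)) →
         Generated G (x ∘[ i ] y)

data CompGens : Word → Set where
  g00 : CompGens (false ∷ false ∷ [])
  g01 : CompGens (false ∷ true ∷ [])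

InComp : Word → Set
InComp = Generated CompGens

-- The elements of Comp of arity n, as a setoid (two elements are equal
-- when they are the same word; membership proofs are irrelevant).
CompArity : ℕ → Setoid _ _
CompArity n = On.setoid {B = Σ Word (λ w → InComp w × length w ≡ n)}
                        (P.setoid Word) proj₁

Compositions : ℕ → Setoid _ _
Compositions n = On.setoid {B = Σ (List ℕ) (λ c → All (0 <_) c × sum c ≡ n)}
                           (P.setoid (List ℕ)) proj₁

-- The free nonsymmetric set-operad on two binary generators a, b:
-- planar binary trees with internal nodes labelled by a or b.

data Gen : Set where
  a b : Gen

data Tree : Set where
  leaf : Tree
  node : Gen → Tree → Tree → Tree

arity : Tree → ℕ
arity leaf = 1
arity (node _ l r) = arity l + arity r

-- partial composition: grafting s onto the i-th leaf (0-based) of t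
graft : (t : Tree) → Fin (arity t) → Tree → Tree
graft leaf _ s = s
graft (node g l r) i s with splitAt (arity l) i
... | inj₁ j = node g (graft l j s) r
... | inj₂ j = node g l (graft r j s)

⟨_⟩ : Gen → Tree
⟨ g ⟩ = node g leaf leaf

-- the four relations  (i ↦ ∘_{i+1})
data Rel : Tree → Tree → Set where
  r1 : Rel (graft ⟨ a ⟩ zero ⟨ a ⟩) (graft ⟨ a ⟩ (suc zero) ⟨ a ⟩)
  r2 : Rel (graft ⟨ b ⟩ zero ⟨ a ⟩) (graft ⟨ a ⟩ (suc zero) ⟨ b ⟩)
  r3 : Rel (graft ⟨ b ⟩ zero ⟨ b ⟩) (graft ⟨ b ⟩ (suc zero) ⟨ a ⟩)
  r4 : Rel (graft ⟨ a ⟩ zero ⟨ b ⟩) (graft ⟨ b ⟩ (suc zero) ⟨ b ⟩)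

data _≈_ : Tree → Tree → Set where
  rel    : ∀ {t s} → Rel t s → t ≈ s
  ≈refl  : ∀ {t} → t ≈ t
  ≈sym   : ∀ {t s} → t ≈ s → s ≈ t
  ≈trans : ∀ {t s u} → t ≈ s → s ≈ u → t ≈ u
  ≈cong  : ∀ {t t' s s'} → t ≈ t' → s ≈ s' → (e : arity t ≡ arity t') →
           (i : Fin (arity t)) → graft t i s ≈ graft t' (cast e i) s'

record IsIsoOntoComp (φ : Tree → Word) : Set where
  field
    into     : ∀ t → InComp (φ t)
    arity-φ  : ∀ t → arity t ≡ length (φ t)
    unit-φ   : φ leaf ≡ 𝟙
    comp-φ   : ∀ t i s → φ (graft t i s) ≡ (φ t ∘[ cast (arity-φ t) i ] φ s)
    respects : ∀ {t s} → t ≈ s → φ t ≡ φ s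
    injective  : ∀ {t s} → φ t ≡ φ s → t ≈ s
    surjective : ∀ {w} → InComp w → ∃[ t ] φ t ≡ w

module Submission where

-- (1) The unit and both generators begin with 0, and a partial composition
--     of two words beginning with 0 again begins with 0; conversely
--     0cu = (0u) ∘₁ (0c), so Comp consists exactly of the words 0u.
-- (2) Reading a word 0u from left to right, every letter 1 opens a new
--     block; the block lengths form a composition of the arity.  The
--     inverse writes a block of size m+1 as 1 0^m (as 0 0^m for the first).
-- (3) Identify a, b with the letters 0, 1, so that Gen becomes the group
--     ℤ/2.  Evaluating trees, φ(node g l r) = φ(l) · (φ(r) + g), is a
--     morphism of operads into Comp that respects the relations.  The four
--     relations all read g ∘₁ h = h ∘₂ (g·h); rotating left subtrees to the
--     right brings every tree into the form of a right comb, and φ maps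
--     right combs bijectively onto the words 0u (the letters being the
--     running sums of the labels).

open import Defs
open import Data.Nat using (ℕ; zero; suc; _+_; _<_; _≤_; s≤s; z≤n)
open import Data.Nat.Properties using (+-suc; +-identityʳ)
open import Data.Nat.ListAction using (sum)
open import Data.Bool using (true; false; _xor_)
open import Data.Bool.Properties using (xor-assoc; xor-identityʳ)
open import Data.List using (List; []; _∷_; length; map; _++_; replicate; drop)
open import Data.List.Properties
  using (map-id; map-∘; map-cong; map-++; ++-assoc; ++-identityʳ; length-++; length-map; length-replicate)
open import Data.List.Relation.Unary.All using (All; []; _∷_)
open import Data.Fin using (Fin; zero; suc; toℕ; cast; splitAt; _↑ʳ_)
open import Data.Fin.Properties
  using (toℕ-↑ˡ; toℕ-↑ʳ; toℕ-cast; toℕ<n; cast-is-id; splitAt⁻¹-↑ˡ; splitAt⁻¹-↑ʳ; splitAt-↑ʳ)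
open import Data.Sum using (inj₁; inj₂)
open import Data.Product using (_×_; _,_; proj₁; ∃-syntax)
open import Function using (_∘_)
open import Function.Bundles using (_⇔_; mk⇔; Equivalence; Bijection)
open import Relation.Binary.Bundles using (Setoid)
open import Relation.Nullary using (contradiction)
open import Relation.Binary.PropositionalEquality
  using (_≡_; refl; sym; trans; cong; cong₂; subst; module ≡-Reasoning)
import Relation.Binary.Reasoning.Setoid as SetoidReasoning

shift : ℕ₂ → Word → Word
shift c = map (c xor_)

shift-false : ∀ w → shift false w ≡ w
shift-false = map-id

shift-shift : ∀ c d w → shift c (shift d w) ≡ shift (c xor d) w
shift-shift c d w = begin
  map (c xor_) (map (d xor_) w)   ≡⟨ map-∘ {g = c xor_} {f = d xor_} w ⟨
  map (λ x → c xor (d xor x)) w   ≡⟨ map-cong (xor-assoc c d) w ⟨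
  map ((c xor d) xor_) w          ∎
  where open ≡-Reasoning

-- The partial composition x ∘ᵢ y with i given as a natural number.
-- Unlike _∘[_]_ its position type does not depend on x, which makes
-- it easy to move positions across concatenations.
_∘⟨_⟩_ : Word → ℕ → Word → Word
[]      ∘⟨ k     ⟩ y = []
(c ∷ x) ∘⟨ zero  ⟩ y = shift c y ++ x
(c ∷ x) ∘⟨ suc k ⟩ y = c ∷ (x ∘⟨ k ⟩ y)

∘-as-∘⟨⟩ : ∀ x i y → x ∘[ i ] y ≡ x ∘⟨ toℕ i ⟩ y
∘-as-∘⟨⟩ (c ∷ x) zero    y = refl
∘-as-∘⟨⟩ (c ∷ x) (suc i) y = cong (c ∷_) (∘-as-∘⟨⟩ x i y)

∘⟨⟩-++ˡ : ∀ x z y k → k < length x → (x ++ z) ∘⟨ k ⟩ y ≡ (x ∘⟨ k ⟩ y) ++ z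
∘⟨⟩-++ˡ (c ∷ x) z y zero    _       = sym (++-assoc (shift c y) x z)
∘⟨⟩-++ˡ (c ∷ x) z y (suc k) (s≤s p) = cong (c ∷_) (∘⟨⟩-++ˡ x z y k p)

∘⟨⟩-++ʳ : ∀ x z y k → (x ++ z) ∘⟨ length x + k ⟩ y ≡ x ++ (z ∘⟨ k ⟩ y)
∘⟨⟩-++ʳ []      z y k = refl
∘⟨⟩-++ʳ (c ∷ x) z y k = cong (c ∷_) (∘⟨⟩-++ʳ x z y k)

shift-∘⟨⟩ : ∀ c x k y → shift c (x ∘⟨ k ⟩ y) ≡ shift c x ∘⟨ k ⟩ y
shift-∘⟨⟩ c []      k       y = refl
shift-∘⟨⟩ c (d ∷ x) zero    y = begin
  shift c (shift d y ++ x)           ≡⟨ map-++ (c xor_) (shift d y) x ⟩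
  shift c (shift d y) ++ shift c x   ≡⟨ cong (_++ shift c x) (shift-shift c d y) ⟩
  shift (c xor d) y ++ shift c x     ∎
  where open ≡-Reasoning
shift-∘⟨⟩ c (d ∷ x) (suc k) y = cong ((c xor d) ∷_) (shift-∘⟨⟩ c x k y)

-- Part 1: Comp consists of the words beginning with 0

leading-zero : ∀ {w} → InComp w → ∃[ u ] w ≡ false ∷ u
leading-zero (gen g00) = _ , refl
leading-zero (gen g01) = _ , refl
leading-zero unit      = _ , refl
leading-zero (comp px py i) with leading-zero px | leading-zero py
leading-zero (comp px py zero)    | _ , refl | _ , refl = _ , refl
leading-zero (comp px py (suc i)) | _ , refl | _ , refl = _ , refl

generator : ∀ c → CompGens (false ∷ c ∷ [])
generator false = g00
generator true  = g01

-- 0cu = (0u) ∘₁ (0c), so every word beginning with 0 is generated.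
zero-word-in-Comp : ∀ u → InComp (false ∷ u)
zero-word-in-Comp []      = unit
zero-word-in-Comp (c ∷ u) = comp (zero-word-in-Comp u) (gen (generator c)) zero

comp-elements : ∀ w → InComp w ⇔ (∃[ u ] w ≡ false ∷ u)
comp-elements w = mk⇔ leading-zero λ where (u , refl) → zero-word-in-Comp u

-- Part 2: elements of arity n ≅ compositions of n

-- runs k u: the block lengths read off u when the current block already
-- has k+1 letters; a letter 1 closes it and opens a new block.
runs : ℕ → Word → List ℕ
runs k []          = suc k ∷ []
runs k (false ∷ u) = runs (suc k) u
runs k (true ∷ u)  = suc k ∷ runs 0 u

compositionOf : Word → List ℕ
compositionOf []      = []
compositionOf (_ ∷ u) = runs 0 u

runs-positive : ∀ k u → All (0 <_) (runs k u)
runs-positive k []          = s≤s z≤n ∷ []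
runs-positive k (false ∷ u) = runs-positive (suc k) u
runs-positive k (true ∷ u)  = s≤s z≤n ∷ runs-positive 0 u

sum-runs : ∀ k u → sum (runs k u) ≡ suc k + length u
sum-runs k []          = refl
sum-runs k (false ∷ u) = trans (sum-runs (suc k) u) (cong suc (sym (+-suc k (length u))))
sum-runs k (true ∷ u)  = cong (suc k +_) (sum-runs 0 u)

compositionOf-positive : ∀ w → All (0 <_) (compositionOf w)
compositionOf-positive []      = []
compositionOf-positive (_ ∷ u) = runs-positive 0 u

sum-compositionOf : ∀ w → sum (compositionOf w) ≡ length w
sum-compositionOf []      = refl
sum-compositionOf (_ ∷ u) = sum-runs 0 u

blocks : ℕ₂ → List ℕ → Word
blocks c []          = []
blocks c (zero ∷ r)  = []
blocks c (suc m ∷ r) = c ∷ replicate m false ++ blocks true r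

replicate-false-∷ : ∀ k u → replicate k false ++ false ∷ u ≡ false ∷ replicate k false ++ u
replicate-false-∷ zero    u = refl
replicate-false-∷ (suc k) u = cong (false ∷_) (replicate-false-∷ k u)

blocks-runs : ∀ c k u → blocks c (runs k u) ≡ c ∷ replicate k false ++ u
blocks-runs c k []          = refl
blocks-runs c k (false ∷ u) =
  trans (blocks-runs c (suc k) u) (cong (c ∷_) (sym (replicate-false-∷ k u)))
blocks-runs c k (true ∷ u)  = cong (λ w → c ∷ replicate k false ++ w) (blocks-runs true 0 u)

runs-replicate : ∀ k m u → runs k (replicate m false ++ u) ≡ runs (k + m) u
runs-replicate k zero    u = cong (λ j → runs j u) (sym (+-identityʳ k))
runs-replicate k (suc m) u =
  trans (runs-replicate (suc k) m u) (cong (λ j → runs j u) (sym (+-suc k m)))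

runs-blocks : ∀ j r → All (0 <_) r → runs j (blocks true r) ≡ suc j ∷ r
runs-blocks j []          []      = refl
runs-blocks j (suc m ∷ r) (_ ∷ p) =
  cong (suc j ∷_) (trans (runs-replicate 0 m (blocks true r)) (runs-blocks m r p))

compositionOf-blocks : ∀ m r → All (0 <_) r → compositionOf (blocks false (suc m ∷ r)) ≡ suc m ∷ r
compositionOf-blocks m r p = trans (runs-replicate 0 m (blocks true r)) (runs-blocks m r p)

compositionOf-injective : ∀ u v → compositionOf (false ∷ u) ≡ compositionOf (false ∷ v) → u ≡ v
compositionOf-injective u v eq = cong (drop 1) (begin
  false ∷ u                                  ≡⟨ blocks-runs false 0 u ⟨
  blocks false (compositionOf (false ∷ u))   ≡⟨ cong (blocks false) eq ⟩
  blocks false (compositionOf (false ∷ v))   ≡⟨ blocks-runs false 0 v ⟩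
  false ∷ v                                  ∎)
  where open ≡-Reasoning

length-blocks : ∀ c r → All (0 <_) r → length (blocks c r) ≡ sum r
length-blocks c []          []      = refl
length-blocks c (suc m ∷ r) (_ ∷ p) = cong suc (begin
  length (replicate m false ++ blocks true r)           ≡⟨ length-++ (replicate m false) ⟩
  length (replicate m false) + length (blocks true r)   ≡⟨ cong₂ _+_ (length-replicate m) (length-blocks true r p) ⟩
  m + sum r                                             ∎)
  where open ≡-Reasoning

arity-compositions : ∀ n → 1 ≤ n → Bijection (CompArity n) (Compositions n)
arity-compositions n 1≤n = record
  { to        = toComposition
  ; cong      = cong compositionOf
  ; bijective = (λ {x} {y} → injective {x} {y}) , surjective
  }
  where
  Element Composition : Set
  Element     = Setoid.Carrier (CompArity n)
  Composition = Setoid.Carrier (Compositions n)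

  toComposition : Element → Composition
  toComposition (w , _ , e) = compositionOf w , compositionOf-positive w , trans (sum-compositionOf w) e

  injective : ∀ {x y : Element} → compositionOf (proj₁ x) ≡ compositionOf (proj₁ y) → proj₁ x ≡ proj₁ y
  injective {w , p , _} {v , q , _} eq with leading-zero p | leading-zero q
  ... | u , refl | u' , refl = cong (false ∷_) (compositionOf-injective u u' eq)

  surjective : ∀ (c : Composition) →
               ∃[ x ] (∀ {z : Element} → proj₁ z ≡ proj₁ x → compositionOf (proj₁ z) ≡ proj₁ c)
  surjective ([] , _ , e) = contradiction (subst (1 ≤_) (sym e) 1≤n) λ ()
  surjective ((suc m ∷ r) , (_ ∷ p) , e) =
    (blocks false (suc m ∷ r) , zero-word-in-Comp _ , trans (length-blocks false (suc m ∷ r) (s≤s z≤n ∷ p)) e)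
    , λ eq → trans (cong compositionOf eq) (compositionOf-blocks m r p)

-- Part 3: the presentation

-- Gen as the group ℤ/2 with unit a, via the isomorphism bit onto (ℕ₂, xor).
bit : Gen → ℕ₂
bit a = false
bit b = true

letter : ℕ₂ → Gen
letter false = a
letter true  = b

bit-letter : ∀ c → bit (letter c) ≡ c
bit-letter false = refl
bit-letter true  = refl

letter-bit : ∀ g → letter (bit g) ≡ g
letter-bit a = refl
letter-bit b = refl

_·_ : Gen → Gen → Gen
g · h = letter (bit g xor bit h)

-- Evaluation of trees in Tℕ₂:  a ↦ 00, b ↦ 01.
φ : Tree → Word
φ leaf         = false ∷ []
φ (node g l r) = φ l ++ shift (bit g) (φ r)

arity-φ : ∀ t → arity t ≡ length (φ t)
arity-φ leaf         = refl
arity-φ (node g l r) = begin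
  arity l + arity r                         ≡⟨ cong₂ _+_ (arity-φ l) (arity-φ r) ⟩
  length (φ l) + length (φ r)               ≡⟨ cong (length (φ l) +_) (length-map (bit g xor_) (φ r)) ⟨
  length (φ l) + length (shift (bit g) (φ r)) ≡⟨ length-++ (φ l) ⟨
  length (φ (node g l r))                   ∎
  where open ≡-Reasoning

toℕ-splitAt-inj₁ : ∀ {m n} {i : Fin (m + n)} {j} → splitAt m i ≡ inj₁ j → toℕ j ≡ toℕ i
toℕ-splitAt-inj₁ {n = n} {j = j} eq = trans (sym (toℕ-↑ˡ j n)) (cong toℕ (splitAt⁻¹-↑ˡ eq))

toℕ-splitAt-inj₂ : ∀ {m n} {i : Fin (m + n)} {j} → splitAt m i ≡ inj₂ j → m + toℕ j ≡ toℕ i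
toℕ-splitAt-inj₂ {m} {j = j} eq = trans (sym (toℕ-↑ʳ m j)) (cong toℕ (splitAt⁻¹-↑ʳ eq))

φ-graft : ∀ t i s → φ (graft t i s) ≡ φ t ∘⟨ toℕ i ⟩ φ s
φ-graft leaf zero s = sym (trans (++-identityʳ (shift false (φ s))) (shift-false (φ s)))
φ-graft (node g l r) i s with splitAt (arity l) i in split
... | inj₁ j = begin
  φ (graft l j s) ++ shift (bit g) (φ r)          ≡⟨ cong (_++ shift (bit g) (φ r)) (φ-graft l j s) ⟩
  (φ l ∘⟨ toℕ j ⟩ φ s) ++ shift (bit g) (φ r)     ≡⟨ ∘⟨⟩-++ˡ (φ l) _ (φ s) (toℕ j) j<|φl| ⟨
  φ (node g l r) ∘⟨ toℕ j ⟩ φ s                   ≡⟨ cong (λ k → φ (node g l r) ∘⟨ k ⟩ φ s) (toℕ-splitAt-inj₁ split) ⟩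
  φ (node g l r) ∘⟨ toℕ i ⟩ φ s                   ∎
  where
  open ≡-Reasoning
  j<|φl| : toℕ j < length (φ l)
  j<|φl| = subst (toℕ j <_) (arity-φ l) (toℕ<n j)
... | inj₂ j = begin
  φ l ++ shift (bit g) (φ (graft r j s))          ≡⟨ cong (λ w → φ l ++ shift (bit g) w) (φ-graft r j s) ⟩
  φ l ++ shift (bit g) (φ r ∘⟨ toℕ j ⟩ φ s)       ≡⟨ cong (φ l ++_) (shift-∘⟨⟩ (bit g) (φ r) (toℕ j) (φ s)) ⟩
  φ l ++ (shift (bit g) (φ r) ∘⟨ toℕ j ⟩ φ s)     ≡⟨ ∘⟨⟩-++ʳ (φ l) _ (φ s) (toℕ j) ⟨
  φ (node g l r) ∘⟨ length (φ l) + toℕ j ⟩ φ s    ≡⟨ cong (λ k → φ (node g l r) ∘⟨ k + toℕ j ⟩ φ s) (arity-φ l) ⟨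
  φ (node g l r) ∘⟨ arity l + toℕ j ⟩ φ s         ≡⟨ cong (λ k → φ (node g l r) ∘⟨ k ⟩ φ s) (toℕ-splitAt-inj₂ split) ⟩
  φ (node g l r) ∘⟨ toℕ i ⟩ φ s                   ∎
  where open ≡-Reasoning

comp-φ : ∀ t i s → φ (graft t i s) ≡ (φ t ∘[ cast (arity-φ t) i ] φ s)
comp-φ t i s = begin
  φ (graft t i s)                          ≡⟨ φ-graft t i s ⟩
  φ t ∘⟨ toℕ i ⟩ φ s                       ≡⟨ cong (λ k → φ t ∘⟨ k ⟩ φ s) (toℕ-cast (arity-φ t) i) ⟨
  φ t ∘⟨ toℕ (cast (arity-φ t) i) ⟩ φ s    ≡⟨ ∘-as-∘⟨⟩ (φ t) (cast (arity-φ t) i) (φ s) ⟨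
  φ t ∘[ cast (arity-φ t) i ] φ s          ∎
  where open ≡-Reasoning

respects : ∀ {t s} → t ≈ s → φ t ≡ φ s
respects (rel r1)     = refl
respects (rel r2)     = refl
respects (rel r3)     = refl
respects (rel r4)     = refl
respects ≈refl        = refl
respects (≈sym p)     = sym (respects p)
respects (≈trans p q) = trans (respects p) (respects q)
respects (≈cong {t} {t'} {s} {s'} p q e i) = begin
  φ (graft t i s)                  ≡⟨ φ-graft t i s ⟩
  φ t ∘⟨ toℕ i ⟩ φ s               ≡⟨ cong₂ (λ x y → x ∘⟨ toℕ i ⟩ y) (respects p) (respects q) ⟩
  φ t' ∘⟨ toℕ i ⟩ φ s'             ≡⟨ cong (λ k → φ t' ∘⟨ k ⟩ φ s') (toℕ-cast e i) ⟨
  φ t' ∘⟨ toℕ (cast e i) ⟩ φ s'    ≡⟨ φ-graft t' (cast e i) s' ⟨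
  φ (graft t' (cast e i) s')       ∎
  where open ≡-Reasoning

φ-leading-zero : ∀ t → ∃[ u ] φ t ≡ false ∷ u
φ-leading-zero leaf = _ , refl
φ-leading-zero (node g l r) with φ l | φ-leading-zero l
... | .(false ∷ u) | u , refl = _ , refl

≈-setoid : Setoid _ _
≈-setoid = record
  { Carrier       = Tree
  ; _≈_           = _≈_
  ; isEquivalence = record { refl = ≈refl ; sym = ≈sym ; trans = ≈trans }
  }

congˡ : ∀ g {l l'} r → l ≈ l' → node g l r ≈ node g l' r
congˡ g r p = ≈cong (≈refl {node g leaf r}) p refl zero

graft-right : ∀ g l t j s → graft (node g l t) (arity l ↑ʳ j) s ≡ node g l (graft t j s)
graft-right g l t j s rewrite splitAt-↑ʳ (arity l) (arity t) j = refl

congʳ : ∀ g l {r r'} → r ≈ r' → node g l r ≈ node g l r'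
congʳ g l {r} {r'} p = begin
  node g l r                                 ≡⟨ graft-right g l leaf zero r ⟨
  graft (node g l leaf) i r                  ≈⟨ ≈cong ≈refl p refl i ⟩
  graft (node g l leaf) (cast refl i) r'     ≡⟨ cong (λ j → graft (node g l leaf) j r') (cast-is-id refl i) ⟩
  graft (node g l leaf) i r'                 ≡⟨ graft-right g l leaf zero r' ⟩
  node g l r'                                ∎
  where
  open SetoidReasoning ≈-setoid
  i : Fin (arity l + 1)
  i = arity l ↑ʳ zero

-- The four relations are exactly the rotations  g ∘₁ h = h ∘₂ (g·h) ...
rotation : ∀ g h → node g ⟨ h ⟩ leaf ≈ node h leaf ⟨ g · h ⟩
rotation a a = rel r1
rotation b a = rel r2
rotation b b = rel r3
rotation a b = rel r4

-- ... which extend to arbitrary subtrees by grafting into the three leaves.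
rotate : ∀ g h A B C → node g (node h A B) C ≈ node h A (node (g · h) B C)
rotate g h A B C =
  ≈cong (≈cong (≈cong (rotation g h) (≈refl {C}) refl (suc (suc zero))) (≈refl {B}) refl (suc zero))
    (≈refl {A}) refl zero

comb : List Gen → Tree
comb []       = leaf
comb (g ∷ gs) = node g leaf (comb gs)

merge : Gen → List Gen → List Gen → List Gen
merge g []       cs = g ∷ cs
merge g (h ∷ hs) cs = h ∷ merge (g · h) hs cs

comb-merge : ∀ g hs cs → node g (comb hs) (comb cs) ≈ comb (merge g hs cs)
comb-merge g []       cs = ≈refl
comb-merge g (h ∷ hs) cs =
  ≈trans (rotate g h leaf (comb hs) (comb cs)) (congʳ h leaf (comb-merge (g · h) hs cs))

normalForm : Tree → List Gen
normalForm leaf         = []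
normalForm (node g l r) = merge g (normalForm l) (normalForm r)

normalise : ∀ t → t ≈ comb (normalForm t)
normalise leaf         = ≈refl
normalise (node g l r) = begin
  node g l r                                        ≈⟨ congˡ g r (normalise l) ⟩
  node g (comb (normalForm l)) r                    ≈⟨ congʳ g _ (normalise r) ⟩
  node g (comb (normalForm l)) (comb (normalForm r)) ≈⟨ comb-merge g (normalForm l) (normalForm r) ⟩
  comb (normalForm (node g l r))                    ∎
  where open SetoidReasoning ≈-setoid

code : ℕ₂ → List Gen → Word
code d []       = []
code d (g ∷ gs) = (d xor bit g) ∷ code (d xor bit g) gs

decode : ℕ₂ → Word → List Gen
decode d []      = []
decode d (c ∷ u) = letter (d xor c) ∷ decode c u

xor-cancelˡ : ∀ d c → d xor (d xor c) ≡ c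
xor-cancelˡ false c     = refl
xor-cancelˡ true  false = refl
xor-cancelˡ true  true  = refl

decode-code : ∀ d gs → decode d (code d gs) ≡ gs
decode-code d []       = refl
decode-code d (g ∷ gs) =
  cong₂ _∷_ (trans (cong letter (xor-cancelˡ d (bit g))) (letter-bit g)) (decode-code (d xor bit g) gs)

code-decode : ∀ d u → code d (decode d u) ≡ u
code-decode d []      = refl
code-decode d (c ∷ u) rewrite bit-letter (d xor c) | xor-cancelˡ d c = cong (c ∷_) (code-decode c u)

shift-code : ∀ c d gs → shift c (code d gs) ≡ code (c xor d) gs
shift-code c d []       = refl
shift-code c d (g ∷ gs) rewrite shift-code c (d xor bit g) gs | xor-assoc c d (bit g) = refl

φ-comb : ∀ gs → φ (comb gs) ≡ false ∷ code false gs
φ-comb []       = refl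
φ-comb (g ∷ gs) = cong (false ∷_) (begin
  shift (bit g) (φ (comb gs))                            ≡⟨ cong (shift (bit g)) (φ-comb gs) ⟩
  (bit g xor false) ∷ shift (bit g) (code false gs)      ≡⟨ cong (_ ∷_) (shift-code (bit g) false gs) ⟩
  (bit g xor false) ∷ code (bit g xor false) gs          ≡⟨ cong (λ c → c ∷ code c gs) (xor-identityʳ (bit g)) ⟩
  bit g ∷ code (bit g) gs                                ∎)
  where open ≡-Reasoning

normalForm-from-φ : ∀ t → decode false (drop 1 (φ t)) ≡ normalForm t
normalForm-from-φ t = begin
  decode false (drop 1 (φ t))                         ≡⟨ cong (decode false ∘ drop 1) (respects (normalise t)) ⟩
  decode false (drop 1 (φ (comb (normalForm t))))     ≡⟨ cong (decode false ∘ drop 1) (φ-comb (normalForm t)) ⟩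
  decode false (code false (normalForm t))            ≡⟨ decode-code false (normalForm t) ⟩
  normalForm t                                        ∎
  where open ≡-Reasoning

φ-injective : ∀ {t s} → φ t ≡ φ s → t ≈ s
φ-injective {t} {s} e = begin
  t                      ≈⟨ normalise t ⟩
  comb (normalForm t)    ≡⟨ cong comb same-normal-form ⟩
  comb (normalForm s)    ≈⟨ normalise s ⟨
  s                      ∎
  where
  open SetoidReasoning ≈-setoid
  same-normal-form : normalForm t ≡ normalForm s
  same-normal-form = trans (sym (normalForm-from-φ t))
    (trans (cong (decode false ∘ drop 1) e) (normalForm-from-φ s))

φ-surjective : ∀ {w} → InComp w → ∃[ t ] φ t ≡ w
φ-surjective p with leading-zero p
... | u , refl = comb (decode false u) , trans (φ-comb (decode false u)) (cong (false ∷_) (code-decode false u))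

φ-iso : IsIsoOntoComp φ
φ-iso = record
  { into       = λ t → Equivalence.from (comp-elements (φ t)) (φ-leading-zero t)
  ; arity-φ    = arity-φ
  ; unit-φ     = refl
  ; comp-φ     = comp-φ
  ; respects   = respects
  ; injective  = φ-injective
  ; surjective = φ-surjective
  }


mainTheorem7 : (∀ w → InComp w ⇔ (∃[ w' ] w ≡ false ∷ w'))
               × (∀ n → 1 ≤ n → Bijection (CompArity n) (Compositions n))
               × (∃[ φ ] IsIsoOntoComp φ)
mainTheorem7 = comp-elements , arity-compositions , φ , φ-iso
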